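{- Let $\alpha,\beta,\varepsilon>0$ and $m,n\in\mathbb N$ with $\beta m/6\ge 2\varepsilon n$. Let $D$ be an $n$-vertex $\varepsilon n$-bipseudorandom digraph with $\delta(D)\ge 2\alpha n$, and suppose $D$ has an $(\alpha,\beta,m)$-reservoir $X$. Let $R\subseteq V(D)\setminus X$ with $|R|\ge 2$, and let $v,v'\in R$ be distinct. Let $P$ be an oriented path on $|R|+\beta m$ vertices containing at least $4|R|-6$ swap vertices. If $(v,v')$ is $(\alpha/2)$-compatible with $P$, then there exists a copy of $P$ in $D[R\cup X]$ with startpoint $v$ and endpoint $v'$ that covers $R$.
   Context: $\delta(D)$ is the minimum total degree (indegree plus outdegree). $d^\pm$, $N^\pm$ denote out/in-degrees and neighbourhoods in $D$. For $1\le t\le n/2$, an $n$-vertex digraph is $t$-bipseudorandom if for every pair of disjoint vertex sets $U,W$ with $|U|=|W|=t$ there exist $u\in U$, $w\in W$ with both $uw$ and $wu$ edges (here $\varepsilon n$ is treated as an integer). A set $X\subseteq V(D)$ is an $(\alpha,\beta,m)$-reservoir if: $|X|=(1+\beta)m$ with $m,\beta m$ integers; for all $v\in V(D)$ and $*\in\{+,-\}$, $d^*(v)\ge\alpha n/2$ implies $|N^*(v)\cap X|\ge 2\beta m$; and there is a partition $X=X^+\cup X^-$ with $|X^+|,|X^-|\ge 2\beta m$ and $d^*(v)\ge\alpha n/2$ for all $v\in X^*$, $*\in\{+,-\}$. An oriented path $P=(u_1,\dots,u_k)$ is an undirected path each of whose edges is given exactly one direction; $\sigma(u_iu_{i+1})=+$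 if $u_iu_{i+1}\in E(P)$ and $-$ otherwise. For $2\le i\le k-1$, $u_i$ is a swap vertex of $P$ if its indegree in $P$ is $0$ or $2$. $(v_1,v_k)$ is $\gamma$-compatible with $P$ if $d^*(v_1)\ge\gamma n$ for $*=\sigma(u_1u_2)$ and $d^*(v_k)\ge\gamma n$ for $*=\sigma(u_ku_{k-1})$. A copy of $P$ with startpoint $a$ and endpoint $b$ is a sequence of distinct vertices $(v_1,\dots,v_k)$, $v_1=a$, $v_k=b$, with $v_iv_{i+1}\in E(D)$ (resp. $v_{i+1}v_i\in E(D)$) whenever $u_iu_{i+1}\in E(P)$ (resp. $u_{i+1}u_i\in E(P)$); it covers $R$ if it contains all vertices of $R$.
   Formalization: The parameters α, β and ε are taken in the positive rationals. -}

module Defs where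

open import Data.Nat as ℕ using (ℕ; zero; suc; _+_; _∸_)
open import Data.Integer using (+_)
open import Data.Rational as ℚ using (ℚ; _/_)
open import Data.Fin using (Fin; zero; suc; inject₁; fromℕ)
open import Data.Fin.Subset using (Subset; _∈_; _∉_; _∩_; _∪_; ∣_∣; Empty)
open import Data.Vec using (tabulate)
open import Data.Bool using (Bool; true; false; _∧_; _∨_; not)
open import Data.Product using (Σ; ∃; ∃-syntax; _×_)
open import Data.Sum using (_⊎_)
open import Relation.Binary.PropositionalEquality using (_≡_; _≢_)
open import Relation.Nullary using (does)
open import Function.Definitions using (Injective)

⟦_⟧ : ℕ → ℚ
⟦ k ⟧ = + k / 1

-- A (simple, loopless) digraph on vertex set Fin n; adj u w = true iff uw ∈ E(D).
record Digraph (n : ℕ) : Set where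
  field
    adj     : Fin n → Fin n → Bool
    noLoops : ∀ v → adj v v ≡ false
open Digraph public

Edge : ∀ {n} → Digraph n → Fin n → Fin n → Set
Edge D u w = adj D u w ≡ true

-- Directions: true = "+" (out), false = "-" (in)
Sign : Set
Sign = Bool

N : ∀ {n} → Digraph n → Sign → Fin n → Subset n
N D true  v = tabulate (λ w → adj D v w)
N D false v = tabulate (λ w → adj D w v)

deg : ∀ {n} → Digraph n → Sign → Fin n → ℕ
deg D s v = ∣ N D s v ∣

totdeg : ∀ {n} → Digraph n → Fin n → ℕ
totdeg D v = deg D true v + deg D false v

MinTotDegAtLeast : ∀ {n} → Digraph n → ℚ → Set
MinTotDegAtLeast D c = ∀ v → c ℚ.≤ ⟦ totdeg D v ⟧

Bipseudorandom : ∀ {n} → ℕ → Digraph n → Set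
Bipseudorandom {n} t D =
  (1 ℕ.≤ t) × (2 ℕ.* t ℕ.≤ n) ×
  (∀ (U W : Subset n) → Empty (U ∩ W) → ∣ U ∣ ≡ t → ∣ W ∣ ≡ t →
     ∃[ u ] ∃[ w ] (u ∈ U × w ∈ W × Edge D u w × Edge D w u))

Reservoir : ∀ {n} → Digraph n → ℚ → ℚ → ℕ → Subset n → Set
Reservoir {n} D α β m X =
  Σ ℕ λ b → (⟦ b ⟧ ≡ β ℚ.* ⟦ m ⟧) ×
  (∣ X ∣ ≡ m + b) ×
  (∀ v (s : Sign) → α ℚ.* ⟦ n ⟧ ℚ.* (+ 1 / 2) ℚ.≤ ⟦ deg D s v ⟧ →
      2 ℕ.* b ℕ.≤ ∣ N D s v ∩ X ∣) ×
  (Σ (Subset n) λ X⁺ → Σ (Subset n) λ X⁻ →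
      (X⁺ ∪ X⁻ ≡ X) × Empty (X⁺ ∩ X⁻) ×
      (2 ℕ.* b ℕ.≤ ∣ X⁺ ∣) × (2 ℕ.* b ℕ.≤ ∣ X⁻ ∣) ×
      (∀ v → v ∈ X⁺ → α ℚ.* ⟦ n ⟧ ℚ.* (+ 1 / 2) ℚ.≤ ⟦ deg D true v ⟧) ×
      (∀ v → v ∈ X⁻ → α ℚ.* ⟦ n ⟧ ℚ.* (+ 1 / 2) ℚ.≤ ⟦ deg D false v ⟧))

-- An oriented path on suc l vertices u_0,…,u_l (0-indexed); edge j joins u_j and u_{j+1};
-- dir j = true means u_j u_{j+1} ∈ E(P) (σ = +), false means u_{j+1} u_j ∈ E(P) (σ = -).
OPath : ℕ → Set
OPath l = Fin l → Bool

count : ∀ {k} → (Fin k → Bool) → ℕ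
count {zero}  f = 0
count {suc k} f = (if f zero then 1 else 0) + count (λ i → f (suc i))
  where
  open import Data.Bool using (if_then_else_)

headP : ∀ {l} → OPath l → Fin l → Fin (suc l)
headP P j with P j
... | true  = suc j
... | false = inject₁ j

indeg : ∀ {l} → OPath l → Fin (suc l) → ℕ
indeg P i = count (λ j → does (headP P j Data.Fin.≟ i))

isSwap : ∀ {l} → OPath l → Fin (suc l) → Bool
isSwap {l} P i =
  not (does (i Data.Fin.≟ zero)) ∧ not (does (i Data.Fin.≟ fromℕ l)) ∧
  (does (indeg P i ℕ.≟ 0) ∨ does (indeg P i ℕ.≟ 2))

swaps : ∀ {l} → OPath l → ℕ
swaps P = count (isSwap P)

-- σ(u_1u_2) and σ(u_k u_{k-1}) (paper's 1-indexing), for paths with ≥ 2 vertices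
σfirst : ∀ {l} → OPath (suc l) → Sign
σfirst P = P zero

σlast : ∀ {l} → OPath (suc l) → Sign
σlast {l} P = not (P (fromℕ l))

Compatible : ∀ {n l} → Digraph n → ℚ → OPath (suc l) → Fin n → Fin n → Set
Compatible {n} D γ P a b =
  (γ ℚ.* ⟦ n ⟧ ℚ.≤ ⟦ deg D (σfirst P) a ⟧) × (γ ℚ.* ⟦ n ⟧ ℚ.≤ ⟦ deg D (σlast P) b ⟧)

IsCopy : ∀ {n l} → Digraph n → OPath l → (Fin (suc l) → Fin n) → Set
IsCopy D P f =
  Injective _≡_ _≡_ f ×
  (∀ j → (P j ≡ true → Edge D (f (inject₁ j)) (f (suc j))) ×
         (P j ≡ false → Edge D (f (suc j)) (f (inject₁ j))))

-- Let s(r) be a direction in which r has at least αn/2 neighbours, hence at least 2βm of them in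
-- the reservoir X.  The vertices of R other than v, v' are placed at swap vertices of P whose two
-- path edges both leave r (s(r) = +) or both enter r (s(r) = -); counting sign changes, 4|R| - 6
-- swaps leave room to choose these positions in order with at least two vertices between consecutive
-- ones.  Each gap is filled by a path of digons (pairs of opposite edges) inside X, which fits any
-- orientation, whose ends lie in the right neighbourhoods of the two R-vertices it joins.  Digon
-- paths of every prescribed length exist: in an εn-bipseudorandom digraph depth-first search finds a
-- digon path covering all but 2εn vertices of any set, and sliding a window along it yields a subpath
-- whose two ends have digons into the prescribed neighbourhoods.  At most βm vertices of X are used
-- in total, and βm ≥ 12εn keeps all neighbourhoods large enough throughout.

module Submission where

open import Defs
open import Data.Nat using (ℕ; suc; _+_; _*_; _∸_; _≤_)
open import Data.Integer using (+_)
open import Data.Rational using (ℚ; 0ℚ; _/_; _<_)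
open import Data.Rational as Q using ()
open import Data.Fin using (Fin; zero; fromℕ)
open import Data.Fin.Subset using (Subset; _∈_; _∉_; _∪_; ∣_∣)
open import Data.Product using (Σ; _×_; ∃-syntax)
open import Relation.Binary.PropositionalEquality using (_≡_; _≢_)

open import Data.Nat using (zero; z≤n; s≤s)
open import Data.Nat.Properties
  using (≤-refl; ≤-reflexive; ≤-trans; ≤-antisym; ≤-pred; _≤?_; ≰⇒>; <⇒≤; <⇒≱; n≤1+n; m≤m+n; m≤n+m;
         +-suc; +-comm; +-assoc; +-identityʳ; +-mono-≤; +-monoˡ-≤; +-monoʳ-≤; +-mono-<; +-cancelˡ-≤; +-cancelʳ-≤;
         *-suc; m+n∸n≡m; m≤n⇒m⊓n≡m; suc-injective; module ≤-Reasoning)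
open import Data.Nat.Tactic.RingSolver using (solve-∀)
open import Data.Nat.Coprimality using (1-coprimeTo)
import Data.Nat.Coprimality as Coprimality
open import Data.Integer using (+≤+)
import Data.Integer as ℤ
import Data.Integer.Properties as ℤ
open import Data.Rational using (mkℚ; 1ℚ; *≤*; nonNegative)
import Data.Rational.Properties as Q
open import Data.Fin using (suc; inject₁; _≟_)
open import Data.Fin.Subset using (inside; outside; ⁅_⁆; _∩_; Empty) renaming (⊥ to ∅)
open import Data.Fin.Subset.Properties using (x∈p∪q⁺; x∈p∪q⁻; x∈p∩q⁻; x∈⁅x⁆; x∈⁅y⁆⇒x≡y; ∉⊥)
import Data.Fin.Properties as Fin
open import Data.Bool using (Bool; true; false; not; _xor_; if_then_else_)
open import Data.Bool.Properties using (¬-not; not-injective; not-involutive) renaming (_≟_ to _≟ᵇ_)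
open import Data.Vec using ([]; _∷_; here; there)
open import Data.Vec.Properties using (lookup∘tabulate; []=⇒lookup)
open import Data.Vec.Functional using () renaming (_∷_ to _◂_)
open import Data.List using (List; []; _∷_; _++_; length; map; take; drop; filter; tabulate; _∷ʳ_; initLast; _∷ʳ′_)
open import Data.List.Properties
  using (length-map; length-++; length-++-sucʳ; length-++-≤ˡ; length-++-≤ʳ; length-take; length-tabulate; ++-assoc)
open import Data.List.Membership.Propositional using (find; lose) renaming (_∈_ to _∈ₗ_; _∉_ to _∉ₗ_)
open import Data.List.Membership.Propositional.Properties
  using (∈-map⁺; ∈-map⁻; ∈-++⁺ˡ; ∈-++⁺ʳ; ∈-++⁻; ∈-∃++; ∈-insert; ∈-filter⁻; ∈-filter⁺)
open import Data.List.Relation.Unary.Any using (Any; here; there; any?)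
import Data.List.Relation.Unary.All as All
open import Data.List.Relation.Unary.All.Properties using (¬Any⇒All¬; All¬⇒¬Any)
import Data.List.Relation.Unary.All.Properties as All
open import Data.List.Relation.Unary.Unique.Propositional using (Unique; []; _∷_) renaming (tail to unique-tail)
open import Data.List.Relation.Unary.Unique.Propositional.Properties using (Unique[x∷xs]⇒x∉xs)
import Data.List.Relation.Unary.Unique.Propositional.Properties as Unique
open import Data.List.Relation.Unary.Linked using (Linked; []; [-]; _∷_)
import Data.List.Relation.Unary.Linked as Linked
open import Data.List.Relation.Binary.Subset.Propositional using (_⊆_)
open import Data.List.Relation.Binary.Subset.Propositional.Properties using (filter-⊆)
open import Data.List.Relation.Binary.Disjoint.Propositional using (Disjoint)
open import Data.Product using (∃; ∃₂; _,_; proj₁; proj₂)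
open import Data.Sum using (_⊎_; inj₁; inj₂)
open import Data.Empty using (⊥; ⊥-elim)
open import Function using (_∘_; const; case_of_)
open import Function.Definitions using (Injective)
open import Relation.Nullary using (¬_; yes; no; does; _×-dec_)
open import Relation.Unary using (Decidable)
open import Relation.Unary.Properties using (∁?)
open import Relation.Binary using (DecidableEquality) renaming (Decidable to Decidable₂)
open import Relation.Binary.PropositionalEquality using (refl; sym; trans; cong; cong₂; subst; subst₂; module ≡-Reasoning)

private variable
  A : Set

lastOf : A → List A → A
lastOf x []       = x
lastOf _ (y ∷ ys) = lastOf y ys

length-∷ʳ : ∀ (xs : List A) x → length (xs ++ x ∷ []) ≡ suc (length xs)
length-∷ʳ []       x = refl
length-∷ʳ (_ ∷ xs) x = cong suc (length-∷ʳ xs x)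

lastOf-++ : ∀ (x : A) xs y ys → lastOf x (xs ++ y ∷ ys) ≡ lastOf y ys
lastOf-++ x []       y ys = refl
lastOf-++ x (z ∷ xs) y ys = lastOf-++ z xs y ys

lastOf-tabulate : ∀ {k} (f : Fin (suc k) → A) → lastOf (f zero) (tabulate (f ∘ suc)) ≡ f (fromℕ k)
lastOf-tabulate {k = zero}  f = refl
lastOf-tabulate {k = suc k} f = lastOf-tabulate (f ∘ suc)

unique-∷ : ∀ {x : A} {xs} → x ∉ₗ xs → Unique xs → Unique (x ∷ xs)
unique-∷ x∉xs u = ¬Any⇒All¬ _ x∉xs ∷ u

unique-delete : ∀ xs {y : A} {ys} → Unique (xs ++ y ∷ ys) → y ∉ₗ xs ++ ys × Unique (xs ++ ys)
unique-delete []       (y≢ys ∷ u) = All¬⇒¬Any y≢ys , u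
unique-delete (x ∷ xs) {y} {ys} (x≢ ∷ u) with unique-delete xs u
... | y∉ , u′ = y∉x∷ , All.++⁺ (All.++⁻ˡ xs x≢) (All.tail (All.++⁻ʳ xs x≢)) ∷ u′
  where
  y∉x∷ : y ∉ₗ x ∷ xs ++ ys
  y∉x∷ (here refl) = All.head (All.++⁻ʳ xs x≢) refl
  y∉x∷ (there y∈)  = y∉ y∈

∈-delete : ∀ (ys : List A) {x z zs} → z ∈ₗ ys ++ x ∷ zs → z ≢ x → z ∈ₗ ys ++ zs
∈-delete ys z∈ z≢x with ∈-++⁻ ys z∈
... | inj₁ z∈ys         = ∈-++⁺ˡ z∈ys
... | inj₂ (here z≡x)   = ⊥-elim (z≢x z≡x)
... | inj₂ (there z∈zs) = ∈-++⁺ʳ ys z∈zs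

⊆-insert : ∀ (xs : List A) {y ys} → xs ++ ys ⊆ xs ++ y ∷ ys
⊆-insert xs z∈ with ∈-++⁻ xs z∈
... | inj₁ z∈xs = ∈-++⁺ˡ z∈xs
... | inj₂ z∈ys = ∈-++⁺ʳ xs (there z∈ys)

unique⇒length-≤ : ∀ {xs ys : List A} → Unique xs → xs ⊆ ys → length xs ≤ length ys
unique⇒length-≤ [] _ = z≤n
unique⇒length-≤ {xs = x ∷ xs} u@(_ ∷ uxs) xs⊆ys with ∈-∃++ (xs⊆ys (here refl))
... | ys , zs , refl =
  subst (suc (length xs) ≤_) (sym (length-++-sucʳ ys x zs))
    (s≤s (unique⇒length-≤ uxs λ z∈xs →
      ∈-delete ys (xs⊆ys (there z∈xs)) λ { refl → Unique[x∷xs]⇒x∉xs u z∈xs }))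

take-⊆ : ∀ k (xs : List A) → take k xs ⊆ xs
take-⊆ (suc k) (x ∷ xs) (here refl) = here refl
take-⊆ (suc k) (x ∷ xs) (there z∈) = there (take-⊆ k xs z∈)

drop-⊆ : ∀ k (xs : List A) → drop k xs ⊆ xs
drop-⊆ zero    xs       z∈ = z∈
drop-⊆ (suc k) (x ∷ xs) z∈ = there (drop-⊆ k xs z∈)

module _ {R : A → A → Set} where

  linked-take : ∀ k {xs} → Linked R xs → Linked R (take k xs)
  linked-take zero          _          = []
  linked-take (suc k)       []         = []
  linked-take (suc zero)    [-]        = [-]
  linked-take (suc (suc k)) [-]        = [-]
  linked-take (suc zero)    (_ ∷ _)    = [-]
  linked-take (suc (suc k)) (r ∷ rs)   = r ∷ linked-take (suc k) rs

  linked-drop : ∀ k {xs} → Linked R xs → Linked R (drop k xs)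
  linked-drop zero    rs       = rs
  linked-drop (suc k) []       = []
  linked-drop (suc k) [-]      = linked-drop k []
  linked-drop (suc k) (_ ∷ rs) = linked-drop k rs

  linked-∷ʳ : ∀ {x xs y} → Linked R (x ∷ xs) → R (lastOf x xs) y → Linked R (x ∷ xs ++ y ∷ [])
  linked-∷ʳ [-]      r = r ∷ [-]
  linked-∷ʳ (r ∷ rs) r′ = r ∷ linked-∷ʳ rs r′

module _ {P : A → Set} (P? : Decidable P) where

  length-filter-∁ : ∀ xs → length xs ≡ length (filter P? xs) + length (filter (∁? P?) xs)
  length-filter-∁ []       = refl
  length-filter-∁ (x ∷ xs) with P? x
  ... | yes _ = cong suc (length-filter-∁ xs)
  ... | no  _ = trans (cong suc (length-filter-∁ xs)) (sym (+-suc _ _))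

module Removal {A : Set} (_≟_ : DecidableEquality A) where
  open import Data.List.Membership.DecPropositional _≟_ using (_∈?_)

  infixl 5 _∖_
  _∖_ : List A → List A → List A
  xs ∖ G = filter (∁? (_∈? G)) xs

  ∈-∖⁻ : ∀ {x} xs G → x ∈ₗ xs ∖ G → x ∈ₗ xs × x ∉ₗ G
  ∈-∖⁻ xs G = ∈-filter⁻ (∁? (_∈? G)) {xs = xs}

  ∈-∖⁺ : ∀ {x xs} G → x ∈ₗ xs → x ∉ₗ G → x ∈ₗ xs ∖ G
  ∈-∖⁺ G = ∈-filter⁺ (∁? (_∈? G))

  ∖-unique : ∀ {xs} G → Unique xs → Unique (xs ∖ G)
  ∖-unique G = Unique.filter⁺ (∁? (_∈? G))

  length-≤-∖ : ∀ {xs} G → Unique xs → length xs ≤ length (xs ∖ G) + length G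
  length-≤-∖ {xs} G u = begin
    length xs                                            ≡⟨ length-filter-∁ (_∈? G) xs ⟩
    length (filter (_∈? G) xs) + length (xs ∖ G)         ≤⟨ +-monoˡ-≤ _ in-G ⟩
    length G + length (xs ∖ G)                           ≡⟨ +-comm (length G) _ ⟩
    length (xs ∖ G) + length G                           ∎
    where
    open ≤-Reasoning
    in-G : length (filter (_∈? G) xs) ≤ length G
    in-G = unique⇒length-≤ {ys = G} (Unique.filter⁺ (_∈? G) {xs} u) (λ x∈ → proj₂ (∈-filter⁻ (_∈? G) {xs = xs} x∈))

drop-lastOf : ∀ d (x : A) xs → d ≤ length xs → drop d (x ∷ xs) ≡ lastOf x (take d xs) ∷ drop d xs
drop-lastOf zero    x xs       _         = refl
drop-lastOf (suc d) x (y ∷ xs) (s≤s d≤) = drop-lastOf d y xs d≤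

length-take-≤ : ∀ d (xs : List A) → d ≤ length xs → length (take d xs) ≡ d
length-take-≤ d xs d≤ = trans (length-take d xs) (m≤n⇒m⊓n≡m d≤)

module _ {P Q : A → Set} (P? : Decidable P) (Q? : Decidable Q) where

  failure-count : ∀ {x y as bs k} → ¬ (P x × Q y) →
                  k ≤ length (filter (∁? P?) as) + length (filter (∁? Q?) bs) →
                  suc k ≤ length (filter (∁? P?) (x ∷ as)) + length (filter (∁? Q?) (y ∷ bs))
  failure-count {x} {y} ¬pq k≤ with P? x | Q? y
  ... | yes px | yes qy = ⊥-elim (¬pq (px , qy))
  ... | yes _  | no _   = ≤-trans (s≤s k≤) (≤-reflexive (sym (+-suc _ _)))
  ... | no _   | yes _  = s≤s k≤
  ... | no _   | no _   = s≤s (≤-trans k≤ (+-monoʳ-≤ _ (n≤1+n _)))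

  Window : ℕ → List A → Set
  Window d xs = ∃[ i ] ∃₂ λ x ys → x ∷ ys ≡ take (suc d) (drop i xs) × length ys ≡ d × P x × Q (lastOf x ys)

  window : ∀ d k xs → k + d ≤ length xs →
           Window d xs ⊎ k ≤ length (filter (∁? P?) (take k xs)) + length (filter (∁? Q?) (take k (drop d xs)))
  window d zero    xs       _                = inj₂ z≤n
  window d (suc k) (x ∷ xs) (s≤s k+d≤xs) with P? x ×-dec Q? (lastOf x (take d xs))
  ... | yes (px , qy) = inj₁ (0 , x , take d xs , refl , length-take-≤ d xs (≤-trans (m≤n+m d k) k+d≤xs) , px , qy)
  ... | no ¬pq with window d k xs k+d≤xs
  ...   | inj₁ (i , w) = inj₁ (suc i , w)
  ...   | inj₂ k≤ = inj₂ (subst (λ ys → suc k ≤ _ + length (filter (∁? Q?) (take (suc k) ys)))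
                                (sym (drop-lastOf d x xs (≤-trans (m≤n+m d k) k+d≤xs)))
                                (failure-count ¬pq k≤))

-- Subsets of Fin n as duplicate-free lists

toList : ∀ {n} → Subset n → List (Fin n)
toList []            = []
toList (inside ∷ p)  = zero ∷ map suc (toList p)
toList (outside ∷ p) = map suc (toList p)

length-toList : ∀ {n} (p : Subset n) → length (toList p) ≡ ∣ p ∣
length-toList []            = refl
length-toList (inside ∷ p)  = cong suc (trans (length-map suc (toList p)) (length-toList p))
length-toList (outside ∷ p) = trans (length-map suc (toList p)) (length-toList p)

∈-toList⁺ : ∀ {n} {x : Fin n} (p : Subset n) → x ∈ p → x ∈ₗ toList p
∈-toList⁺ (inside ∷ p)  here       = here refl
∈-toList⁺ (inside ∷ p)  (there x∈) = there (∈-map⁺ suc (∈-toList⁺ p x∈))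
∈-toList⁺ (outside ∷ p) (there x∈) = ∈-map⁺ suc (∈-toList⁺ p x∈)

∈-toList⁻ : ∀ {n} {x : Fin n} (p : Subset n) → x ∈ₗ toList p → x ∈ p
∈-toList⁻ (inside ∷ p)  (here refl) = here
∈-toList⁻ (inside ∷ p)  (there x∈) with ∈-map⁻ suc x∈
... | _ , y∈ , refl = there (∈-toList⁻ p y∈)
∈-toList⁻ (outside ∷ p) x∈ with ∈-map⁻ suc x∈
... | _ , y∈ , refl = there (∈-toList⁻ p y∈)

toList-unique : ∀ {n} (p : Subset n) → Unique (toList p)
toList-unique []            = []
toList-unique (inside ∷ p)  = unique-∷ zero∉ (Unique.map⁺ Fin.suc-injective (toList-unique p))
  where
  zero∉ : zero ∉ₗ map suc (toList p)
  zero∉ x∈ with ∈-map⁻ suc x∈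
  ... | _ , _ , ()
toList-unique (outside ∷ p) = Unique.map⁺ Fin.suc-injective (toList-unique p)

fromList : ∀ {n} → List (Fin n) → Subset n
fromList []       = ∅
fromList (x ∷ xs) = ⁅ x ⁆ ∪ fromList xs

∈-fromList⁺ : ∀ {n} {x : Fin n} xs → x ∈ₗ xs → x ∈ fromList xs
∈-fromList⁺ (y ∷ xs) (here refl) = x∈p∪q⁺ (inj₁ (x∈⁅x⁆ y))
∈-fromList⁺ (y ∷ xs) (there x∈)  = x∈p∪q⁺ (inj₂ (∈-fromList⁺ xs x∈))

∈-fromList⁻ : ∀ {n} {x : Fin n} xs → x ∈ fromList xs → x ∈ₗ xs
∈-fromList⁻ []       x∈ = ⊥-elim (∉⊥ x∈)
∈-fromList⁻ (y ∷ xs) x∈ with x∈p∪q⁻ ⁅ y ⁆ (fromList xs) x∈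
... | inj₁ x∈y  = here (x∈⁅y⁆⇒x≡y y x∈y)
... | inj₂ x∈xs = there (∈-fromList⁻ xs x∈xs)

∣fromList∣ : ∀ {n} {xs : List (Fin n)} → Unique xs → ∣ fromList xs ∣ ≡ length xs
∣fromList∣ {xs = xs} u = ≤-antisym
  (≤-trans (≤-reflexive (sym (length-toList (fromList xs))))
     (unique⇒length-≤ {ys = xs} (toList-unique (fromList xs)) (∈-fromList⁻ xs ∘ ∈-toList⁻ (fromList xs))))
  (≤-trans (unique⇒length-≤ {ys = toList (fromList xs)} u (∈-toList⁺ (fromList xs) ∘ ∈-fromList⁺ xs))
     (≤-reflexive (length-toList (fromList xs))))

-- Oriented walks

module _ {n : ℕ} (D : Digraph n) where

  Digon : Fin n → Fin n → Set
  Digon u w = Edge D u w × Edge D w u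

  Arc : Sign → Fin n → Fin n → Set
  Arc true  x y = Edge D x y
  Arc false x y = Edge D y x

  data Follows : List Sign → List (Fin n) → Set where
    [_] : ∀ x → Follows [] (x ∷ [])
    _∷_ : ∀ {s ss x y ys} → Arc s x y → Follows ss (y ∷ ys) → Follows (s ∷ ss) (x ∷ y ∷ ys)

  digon⇒arc : ∀ s {x y} → Digon x y → Arc s x y
  digon⇒arc true  (xy , _) = xy
  digon⇒arc false (_ , yx) = yx

  follows-digons : ∀ {ss x xs} → Linked Digon (x ∷ xs) → length ss ≡ length xs → Follows ss (x ∷ xs)
  follows-digons {[]}     [-]      refl = [ _ ]
  follows-digons {s ∷ ss} (d ∷ ds) eq   = digon⇒arc s d ∷ follows-digons ds (suc-injective eq)

  follows-++ : ∀ {ss s ss′ x xs y ys} → Follows ss (x ∷ xs) → Arc s (lastOf x xs) y → Follows ss′ (y ∷ ys) →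
               Follows (ss ++ s ∷ ss′) (x ∷ xs ++ y ∷ ys)
  follows-++ [ _ ]    arc rest = arc ∷ rest
  follows-++ (a ∷ as) arc rest = a ∷ follows-++ as arc rest

  arc⇒edges : ∀ {s x y} → Arc s x y → (s ≡ true → Edge D x y) × (s ≡ false → Edge D y x)
  arc⇒edges {true}  e = (λ _ → e) , (λ ())
  arc⇒edges {false} e = (λ ()) , (λ _ → e)

  walk⇒copy : ∀ {l} (P : OPath l) {x xs} → Unique (x ∷ xs) → Follows (tabulate P) (x ∷ xs) →
              Σ (Fin (suc l) → Fin n) λ f → IsCopy D P f × f zero ≡ x × f (fromℕ l) ≡ lastOf x xs ×
                (∀ i → f i ∈ₗ x ∷ xs) × (∀ {y} → y ∈ₗ x ∷ xs → ∃ λ i → f i ≡ y)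
  walk⇒copy {zero} P {x} _ [ _ ] =
    const x , (one-point , λ ()) , refl , refl , (λ _ → here refl) , λ { (here refl) → zero , refl }
    where
    one-point : Injective _≡_ _≡_ (const {B = Fin 1} x)
    one-point {zero} {zero} _ = refl
  walk⇒copy {suc l} P {x} {y ∷ ys} u (a ∷ as) with walk⇒copy (P ∘ suc) (unique-tail u) as
  ... | g , (g-inj , g-edges) , g0 , g-last , g-∈ , g-onto =
    x ◂ g , (injective , edges) , refl , g-last , listed , onto
    where
    x∉ : ∀ i → x ≡ g i → ⊥
    x∉ i eq = Unique[x∷xs]⇒x∉xs u (subst (_∈ₗ y ∷ ys) (sym eq) (g-∈ i))
    injective : ∀ {i j} → (x ◂ g) i ≡ (x ◂ g) j → i ≡ j
    injective {zero}  {zero}  _  = refl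
    injective {zero}  {suc j} eq = ⊥-elim (x∉ j eq)
    injective {suc i} {zero}  eq = ⊥-elim (x∉ i (sym eq))
    injective {suc i} {suc j} eq = cong suc (g-inj eq)
    edges : ∀ j → (P j ≡ true → Edge D ((x ◂ g) (inject₁ j)) ((x ◂ g) (suc j))) ×
                  (P j ≡ false → Edge D ((x ◂ g) (suc j)) ((x ◂ g) (inject₁ j)))
    edges zero    = arc⇒edges (subst (Arc (P zero) x) (sym g0) a)
    edges (suc j) = g-edges j
    listed : ∀ i → (x ◂ g) i ∈ₗ x ∷ y ∷ ys
    listed zero    = here refl
    listed (suc i) = there (g-∈ i)
    onto : ∀ {z} → z ∈ₗ x ∷ y ∷ ys → ∃ λ i → (x ◂ g) i ≡ z
    onto (here refl) = zero , refl
    onto (there z∈) with g-onto z∈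
    ... | i , eq = suc i , eq

-- Digon paths in a bipseudorandom digraph

private
  bridge-room : ∀ t d s q → 3 + d + (t + t) + (t + t) ≤ 2 + s → s ≤ q + (t + t) → (t + t) + d ≤ q
  bridge-room t d s q h₁ h₂ =
    +-cancelʳ-≤ (2 + (t + t)) _ _
      (≤-trans (≤-reflexive (e₁ t d)) (≤-trans (n≤1+n _) (≤-trans h₁ (≤-trans (+-monoʳ-≤ 2 h₂) (≤-reflexive (e₂ t q))))))
    where
    e₁ : ∀ t d → t + t + d + (2 + (t + t)) ≡ 2 + d + (t + t) + (t + t)
    e₁ = solve-∀
    e₂ : ∀ t q → 2 + (q + (t + t)) ≡ q + (2 + (t + t))
    e₂ = solve-∀

  cancel-via : ∀ f {x y z} → f + x ≤ y → y ≤ z + f → x ≤ z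
  cancel-via f {x} {y} {z} h₁ h₂ = +-cancelˡ-≤ f x z (≤-trans h₁ (≤-trans h₂ (≤-reflexive (+-comm z f))))

  segment-room-≡ : ∀ L f t → f + (t + t) + (L + (t + t) + (t + t)) ≡ L + f + 6 * t
  segment-room-≡ = solve-∀

module DigonPaths {n : ℕ} (D : Digraph n) (t : ℕ) (bip : Bipseudorandom t D) where

  V : Set
  V = Fin n

  infix 4 _⇄_
  _⇄_ : V → V → Set
  _⇄_ = Digon D

  ⇄-sym : ∀ {u w} → u ⇄ w → w ⇄ u
  ⇄-sym (uw , wu) = wu , uw

  _⇄?_ : Decidable₂ _⇄_
  u ⇄? w = (adj D u w ≟ᵇ true) ×-dec (adj D w u ≟ᵇ true)

  digon-between : ∀ {us ws} → Unique us → Unique ws → Disjoint us ws → t ≤ length us → t ≤ length ws →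
                  ∃₂ λ u w → u ∈ₗ us × w ∈ₗ ws × u ⇄ w
  digon-between {us} {ws} uus uws us#ws t≤us t≤ws
    with proj₂ (proj₂ bip) (fromList (take t us)) (fromList (take t ws)) disjoint (size uus t≤us) (size uws t≤ws)
    where
    disjoint : Empty (fromList (take t us) ∩ fromList (take t ws))
    disjoint (x , x∈) with x∈p∩q⁻ _ _ x∈
    ... | x∈us , x∈ws = us#ws (take-⊆ t us (∈-fromList⁻ _ x∈us) , take-⊆ t ws (∈-fromList⁻ _ x∈ws))
    size : ∀ {xs} → Unique xs → t ≤ length xs → ∣ fromList (take t xs) ∣ ≡ t
    size {xs} u t≤xs = trans (∣fromList∣ (Unique.take⁺ t u)) (trans (length-take t xs) (m≤n⇒m⊓n≡m t≤xs))
  ... | u , w , u∈ , w∈ , uw , wu =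
    u , w , take-⊆ t us (∈-fromList⁻ _ u∈) , take-⊆ t ws (∈-fromList⁻ _ w∈) , uw , wu

  LongPath : List V → Set
  LongPath S = ∃ λ Q → Linked _⇄_ Q × Unique Q × Q ⊆ S × length S ≤ length Q + (t + t)

  -- The state of a depth-first search inside S: P is the current path (its head is the active
  -- vertex), T the vertices whose search has finished, U the vertices not yet visited.
  record DfsState (S P T U : List V) : Set where
    field
      path     : Linked _⇄_ P
      unique-P : Unique P
      unique-T : Unique T
      unique-U : Unique U
      P#T      : Disjoint P T
      P#U      : Disjoint P U
      T#U      : Disjoint T U
      P⊆S      : P ⊆ S
      U⊆S      : U ⊆ S
      covers   : length S ≤ length P + length T + length U
      finished : ∀ {x y} → x ∈ₗ T → y ∈ₗ U → ¬ x ⇄ y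

  module _ {S : List V} where

    push : ∀ {P T} U₁ {y U₂} → DfsState S P T (U₁ ++ y ∷ U₂) → Linked _⇄_ (y ∷ P) →
           DfsState S (y ∷ P) T (U₁ ++ U₂)
    push {P} {T} U₁ {y} {U₂} st path′ = record
      { path     = path′
      ; unique-P = unique-∷ (λ y∈P → P#U (y∈P , y∈U)) unique-P
      ; unique-T = unique-T
      ; unique-U = proj₂ (unique-delete U₁ unique-U)
      ; P#T      = λ { (here refl , y∈T) → T#U (y∈T , y∈U) ; (there x∈P , x∈T) → P#T (x∈P , x∈T) }
      ; P#U      = λ { (here refl , y∈U′) → proj₁ (unique-delete U₁ unique-U) y∈U′
                     ; (there x∈P , x∈U′) → P#U (x∈P , ⊆-insert U₁ x∈U′) }
      ; T#U      = λ (x∈T , x∈U′) → T#U (x∈T , ⊆-insert U₁ x∈U′)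
      ; P⊆S      = λ { (here refl) → U⊆S y∈U ; (there x∈P) → P⊆S x∈P }
      ; U⊆S      = λ x∈U′ → U⊆S (⊆-insert U₁ x∈U′)
      ; covers   = ≤-trans covers (≤-reflexive moved)
      ; finished = λ x∈T y∈U′ → finished x∈T (⊆-insert U₁ y∈U′)
      }
      where
      open DfsState st
      y∈U : y ∈ₗ U₁ ++ y ∷ U₂
      y∈U = ∈-insert U₁
      moved : length P + length T + length (U₁ ++ y ∷ U₂) ≡ suc (length P) + length T + length (U₁ ++ U₂)
      moved = trans (cong (λ k → length P + length T + k) (length-++-sucʳ U₁ y U₂)) (+-suc _ _)

    pop : ∀ {p P T U} → DfsState S (p ∷ P) T U → (∀ {y} → y ∈ₗ U → ¬ p ⇄ y) → DfsState S P (p ∷ T) U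
    pop {p} {P} {T} {U} st stuck = record
      { path     = Linked.tail path
      ; unique-P = unique-tail unique-P
      ; unique-T = unique-∷ (λ p∈T → P#T (here refl , p∈T)) unique-T
      ; unique-U = unique-U
      ; P#T      = λ { (x∈P , here refl) → Unique[x∷xs]⇒x∉xs unique-P x∈P ; (x∈P , there x∈T) → P#T (there x∈P , x∈T) }
      ; P#U      = λ (x∈P , x∈U) → P#U (there x∈P , x∈U)
      ; T#U      = λ { (here refl , p∈U) → P#U (here refl , p∈U) ; (there x∈T , x∈U) → T#U (x∈T , x∈U) }
      ; P⊆S      = λ x∈P → P⊆S (there x∈P)
      ; U⊆S      = U⊆S
      ; covers   = ≤-trans covers (≤-reflexive (cong (_+ length U) (sym (+-suc (length P) (length T)))))
      ; finished = λ { (here refl) y∈U → stuck y∈U ; (there x∈T) y∈U → finished x∈T y∈U }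
      }
      where open DfsState st

    done : ∀ {P T U} → DfsState S P T U → length T ≤ t → length U ≤ t → LongPath S
    done {P} st T≤t U≤t =
      P , path , unique-P , P⊆S ,
      ≤-trans covers (≤-trans (≤-reflexive (+-assoc (length P) _ _)) (+-monoʳ-≤ (length P) (+-mono-≤ T≤t U≤t)))
      where open DfsState st

    measure : List V → List V → ℕ
    measure P U = length U + length U + length P

    measure-push : ∀ P U₁ y U₂ → measure P (U₁ ++ y ∷ U₂) ≡ suc (measure (y ∷ P) (U₁ ++ U₂))
    measure-push P U₁ y U₂ rewrite length-++-sucʳ U₁ y U₂ = lemma (length (U₁ ++ U₂)) (length P)
      where
      lemma : ∀ a c → suc a + suc a + c ≡ suc (a + a + suc c)
      lemma = solve-∀

    measure-pop : ∀ p P U → measure (p ∷ P) U ≡ suc (measure P U)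
    measure-pop p P U = +-suc (length U + length U) (length P)

    dfs : ∀ fuel P T U → DfsState S P T U → measure P U ≤ fuel → length T ≤ t → LongPath S
    dfs fuel P T U st bound T≤t with t ≤? length U | t ≤? length T
    ... | no U≱t | _ = done st T≤t (<⇒≤ (≰⇒> U≱t))
    ... | yes t≤U | yes t≤T with digon-between (DfsState.unique-T st) (DfsState.unique-U st) (DfsState.T#U st) t≤T t≤U
    ...   | x , y , x∈T , y∈U , x⇄y = ⊥-elim (DfsState.finished st x∈T y∈U x⇄y)
    dfs fuel P T [] st bound T≤t | yes t≤0 | no T≱t = ⊥-elim (T≱t (≤-trans t≤0 z≤n))
    dfs (suc fuel) [] T (u ∷ U) st bound T≤t | yes _ | no _ =
      dfs fuel (u ∷ []) T U (push [] st [-]) (≤-pred (≤-trans (≤-reflexive (sym (measure-push [] [] u U))) bound)) T≤t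
    dfs (suc fuel) (p ∷ P) T (u ∷ U) st bound T≤t | yes _ | no T≱t with any? (p ⇄?_) (u ∷ U)
    ... | yes p⇄U with find p⇄U
    ...   | y , y∈U , p⇄y with ∈-∃++ y∈U
    ...     | U₁ , U₂ , eq =
      dfs fuel (y ∷ p ∷ P) T (U₁ ++ U₂) (push U₁ st′ (⇄-sym p⇄y ∷ DfsState.path st))
        (≤-pred (≤-trans (≤-reflexive (sym (measure-push (p ∷ P) U₁ y U₂)))
                         (subst (λ U′ → measure (p ∷ P) U′ ≤ suc fuel) eq bound)))
        T≤t
      where
      st′ : DfsState S (p ∷ P) T (U₁ ++ y ∷ U₂)
      st′ = subst (DfsState S (p ∷ P) T) eq st
    dfs (suc fuel) (p ∷ P) T (u ∷ U) st bound T≤t | yes _ | no T≱t | no p⇏U =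
      dfs fuel P (p ∷ T) (u ∷ U) (pop st λ y∈U p⇄y → p⇏U (lose y∈U p⇄y))
        (≤-pred (≤-trans (≤-reflexive (sym (measure-pop p P (u ∷ U)))) bound)) (≰⇒> T≱t)

  long-digon-path : ∀ {S} → Unique S → LongPath S
  long-digon-path {S} uS = dfs (length S + length S) [] [] S initial (≤-reflexive (+-identityʳ _)) z≤n
    where
    initial : DfsState S [] [] S
    initial = record
      { path = [] ; unique-P = [] ; unique-T = [] ; unique-U = uS
      ; P#T = λ () ; P#U = λ () ; T#U = λ ()
      ; P⊆S = λ () ; U⊆S = λ x∈ → x∈ ; covers = ≤-refl ; finished = λ () }

  private
    no-digon-from : ∀ {Z A} → Unique Z → Unique A → Disjoint Z A → t ≤ length Z → t ≤ length A →
                    (∀ {z} → z ∈ₗ Z → ¬ Any (z ⇄_) A) → ⊥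
    no-digon-from uZ uA Z#A tZ tA isolated with digon-between uZ uA Z#A tZ tA
    ... | z , a , z∈Z , a∈A , z⇄a = isolated z∈Z (lose a∈A z⇄a)

    either-half : ∀ {a b} → t + t ≤ a + b → t ≤ a ⊎ t ≤ b
    either-half {a} {b} 2t≤ with t ≤? a | t ≤? b
    ... | yes t≤a | _       = inj₁ t≤a
    ... | no _    | yes t≤b = inj₂ t≤b
    ... | no t≰a  | no t≰b  = ⊥-elim (<⇒≱ (+-mono-< (≰⇒> t≰a) (≰⇒> t≰b)) 2t≤)

  Adjacent : List V → V → Set
  Adjacent A x = Any (x ⇄_) A

  adjacent? : ∀ A → Decidable (Adjacent A)
  adjacent? A x = any? (x ⇄?_) A

  Bridge : (A S B : List V) → ℕ → Set
  Bridge A S B L = ∃₂ λ a M → Linked _⇄_ (a ∷ M) × Unique (a ∷ M) × a ∷ M ⊆ A ++ S ++ B ×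
                              a ∈ₗ A × lastOf a M ∈ₗ B × suc (length M) ≡ L

  module _ {A S B : List V} (uA : Unique A) (uB : Unique B) (A#S : Disjoint A S) (A#B : Disjoint A B)
           (S#B : Disjoint S B) (tA : t ≤ length A) (tB : t ≤ length B) where

    digon-bridge : Bridge A S B 2
    digon-bridge with digon-between uA uB A#B tA tB
    ... | a , b , a∈A , b∈B , a⇄b =
      a , b ∷ [] , a⇄b ∷ [-] , unique-∷ (λ { (here refl) → A#B (a∈A , b∈B) }) (unique-∷ (λ ()) []) ,
      (λ { (here refl) → ∈-++⁺ˡ a∈A ; (there (here refl)) → ∈-++⁺ʳ A (∈-++⁺ʳ S b∈B) }) , a∈A , b∈B , refl

    module _ {Q : List V} (uQ : Unique Q) (Q⊆S : Q ⊆ S) where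

      sparse-windows : ∀ d →
        ¬ (t + t ≤ length (filter (∁? (adjacent? A)) (take (t + t) Q)) +
                   length (filter (∁? (adjacent? B)) (take (t + t) (drop d Q))))
      sparse-windows d k≤ with either-half k≤
      ... | inj₁ t≤ = no-digon-from (Unique.filter⁺ _ (Unique.take⁺ (t + t) uQ)) uA
                        (λ (z∈ , a∈) → A#S (a∈ , Q⊆S (take-⊆ (t + t) Q (filter-⊆ _ _ z∈)))) t≤ tA
                        (λ z∈ → proj₂ (∈-filter⁻ (∁? (adjacent? A)) {xs = take (t + t) Q} z∈))
      ... | inj₂ t≤ = no-digon-from (Unique.filter⁺ _ (Unique.take⁺ (t + t) (Unique.drop⁺ d uQ))) uB
                        (λ (z∈ , b∈) → S#B (Q⊆S (drop-⊆ d Q (take-⊆ (t + t) (drop d Q) (filter-⊆ _ _ z∈))) , b∈)) t≤ tB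
                        (λ z∈ → proj₂ (∈-filter⁻ (∁? (adjacent? B)) {xs = take (t + t) (drop d Q)} z∈))

      path-bridge : ∀ d → Linked _⇄_ Q → (t + t) + d ≤ length Q → Bridge A S B (3 + d)
      path-bridge d linked-Q room with window (adjacent? A) (adjacent? B) d (t + t) Q room
      ... | inj₂ k≤ = ⊥-elim (sparse-windows d k≤)
      ... | inj₁ (i , x , ys , W≡ , |ys| , x⇄A , y⇄B) with find x⇄A | find y⇄B
      ... | a , a∈A , x⇄a | b , b∈B , y⇄b =
        a , W ++ b ∷ [] , ⇄-sym x⇄a ∷ linked-∷ʳ linked-W y⇄b ,
        unique-∷ a∉ (Unique.++⁺ uW (unique-∷ (λ ()) []) W#b) ,
        path⊆ , a∈A , subst (_∈ₗ B) (sym (lastOf-++ x ys b [])) b∈B , cong (λ k → 2 + k) len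
        where
        W : List V
        W = x ∷ ys
        linked-W : Linked _⇄_ W
        linked-W = subst (Linked _⇄_) (sym W≡) (linked-take (suc d) (linked-drop i linked-Q))
        uW : Unique W
        uW = subst Unique (sym W≡) (Unique.take⁺ (suc d) (Unique.drop⁺ i uQ))
        W⊆S : W ⊆ S
        W⊆S z∈ = Q⊆S (drop-⊆ i Q (take-⊆ (suc d) (drop i Q) (subst (_ ∈ₗ_) W≡ z∈)))
        W#b : Disjoint W (b ∷ [])
        W#b (z∈W , here refl) = S#B (W⊆S z∈W , b∈B)
        a∉ : a ∉ₗ W ++ b ∷ []
        a∉ a∈ with ∈-++⁻ W a∈
        ... | inj₁ a∈W         = A#S (a∈A , W⊆S a∈W)
        ... | inj₂ (here refl) = A#B (a∈A , b∈B)
        path⊆ : a ∷ W ++ b ∷ [] ⊆ A ++ S ++ B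
        path⊆ (here refl) = ∈-++⁺ˡ a∈A
        path⊆ (there z∈) with ∈-++⁻ W z∈
        ... | inj₁ z∈W         = ∈-++⁺ʳ A (∈-++⁺ˡ (W⊆S z∈W))
        ... | inj₂ (here refl) = ∈-++⁺ʳ A (∈-++⁺ʳ S b∈B)
        len : length (ys ++ b ∷ []) ≡ suc d
        len = trans (length-∷ʳ ys b) (cong suc |ys|)

    bridge : ∀ L → Unique S → 2 ≤ L → L + (t + t) + (t + t) ≤ 2 + length S → Bridge A S B L
    bridge (suc (suc zero))    _  _ _    = digon-bridge
    bridge (suc zero)          _  (s≤s ()) _
    bridge (suc (suc (suc d))) uS _ room with long-digon-path uS
    ... | Q , linked-Q , uQ , Q⊆S , S≤Q =
      path-bridge uQ Q⊆S d linked-Q (bridge-room t d (length S) (length Q) room S≤Q)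

  open Removal (Data.Fin._≟_ {n})

  Segment : (X F A B : List V) → ℕ → Set
  Segment X F A B L = ∃₂ λ a M → Linked _⇄_ (a ∷ M) × Unique (a ∷ M) × a ∷ M ⊆ X × Disjoint (a ∷ M) F ×
                                 a ∈ₗ A × lastOf a M ∈ₗ B × suc (length M) ≡ L

  module _ {X F A B : List V} (uX : Unique X) (uA : Unique A) (uB : Unique B) (A⊆X : A ⊆ X) (B⊆X : B ⊆ X)
           (FA : length F + (t + t) ≤ length A) (FB : length F + (t + t) ≤ length B) where

    private
      A′ B′ S : List V
      A′ = take t (A ∖ F)
      B′ = take t (B ∖ (F ++ A′))
      S  = X ∖ (F ++ A′ ++ B′)

      t≤A∖F : t ≤ length (A ∖ F)
      t≤A∖F = ≤-trans (m≤m+n t t) (cancel-via (length F) FA (length-≤-∖ F uA))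
      |A′| : length A′ ≡ t
      |A′| = length-take-≤ t (A ∖ F) t≤A∖F
      t≤B∖FA′ : t ≤ length (B ∖ (F ++ A′))
      t≤B∖FA′ = cancel-via (length F + t) (≤-trans (≤-reflexive (+-assoc (length F) t t)) FB)
                  (≤-trans (length-≤-∖ (F ++ A′) uB) (≤-reflexive (cong (λ k → length (B ∖ (F ++ A′)) + k)
                    (trans (length-++ F) (cong (λ k → length F + k) |A′|)))))

      |B′| : length B′ ≡ t
      |B′| = length-take-≤ t (B ∖ (F ++ A′)) t≤B∖FA′

      A′-inv : ∀ {x} → x ∈ₗ A′ → x ∈ₗ A × x ∉ₗ F
      A′-inv x∈ = ∈-∖⁻ A F (take-⊆ t (A ∖ F) x∈)
      B′-inv : ∀ {x} → x ∈ₗ B′ → x ∈ₗ B × x ∉ₗ F ++ A′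
      B′-inv x∈ = ∈-∖⁻ B (F ++ A′) (take-⊆ t (B ∖ (F ++ A′)) x∈)
      |F++A′++B′| : length (F ++ A′ ++ B′) ≡ length F + (t + t)
      |F++A′++B′| = trans (length-++ F) (cong (λ k → length F + k) (trans (length-++ A′) (cong₂ _+_ |A′| |B′|)))
      S-inv : ∀ {x} → x ∈ₗ S → x ∈ₗ X × x ∉ₗ F ++ A′ ++ B′
      S-inv = ∈-∖⁻ X (F ++ A′ ++ B′)

    digon-segment : ∀ L → 2 ≤ L → L + length F + 6 * t ≤ length X → Segment X F A B L
    digon-segment L 2≤L room
      with bridge (Unique.take⁺ t (∖-unique F uA)) (Unique.take⁺ t (∖-unique (F ++ A′) uB))
             (λ (x∈A′ , x∈S) → proj₂ (S-inv x∈S) (∈-++⁺ʳ F (∈-++⁺ˡ x∈A′)))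
             (λ (x∈A′ , x∈B′) → proj₂ (B′-inv x∈B′) (∈-++⁺ʳ F x∈A′))
             (λ (x∈S , x∈B′) → proj₂ (S-inv x∈S) (∈-++⁺ʳ F (∈-++⁺ʳ A′ x∈B′)))
             (≤-reflexive (sym |A′|)) (≤-reflexive (sym |B′|))
             L (∖-unique (F ++ A′ ++ B′) uX) 2≤L
             (≤-trans (cancel-via (length F + (t + t)) (≤-trans (≤-reflexive (segment-room-≡ L (length F) t)) room)
                        (≤-trans (length-≤-∖ (F ++ A′ ++ B′) uX) (≤-reflexive (cong (λ k → length S + k) |F++A′++B′|))))
                      (m≤n+m _ 2))
    ... | a , M , linked , u , path⊆ , a∈A′ , b∈B′ , len =
      a , M , linked , u , proj₁ ∘ classify ∘ path⊆ , (λ (x∈ , x∈F) → proj₂ (classify (path⊆ x∈)) x∈F) ,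
      proj₁ (A′-inv a∈A′) , proj₁ (B′-inv b∈B′) , len
      where
      classify : ∀ {x} → x ∈ₗ A′ ++ S ++ B′ → x ∈ₗ X × x ∉ₗ F
      classify x∈ with ∈-++⁻ A′ x∈
      ... | inj₁ x∈A′ = A⊆X (proj₁ (A′-inv x∈A′)) , proj₂ (A′-inv x∈A′)
      ... | inj₂ x∈SB′ with ∈-++⁻ S x∈SB′
      ...   | inj₁ x∈S  = proj₁ (S-inv x∈S) , λ x∈F → proj₂ (S-inv x∈S) (∈-++⁺ˡ x∈F)
      ...   | inj₂ x∈B′ = B⊆X (proj₁ (B′-inv x∈B′)) , λ x∈F → proj₂ (B′-inv x∈B′) (∈-++⁺ˡ x∈F)

-- Sign changes along an oriented path

changes : List Sign → ℕ
changes []           = 0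
changes (_ ∷ [])     = 0
changes (x ∷ y ∷ xs) = (if x xor y then 1 else 0) + changes (y ∷ xs)

private
  bit : Bool → ℕ
  bit b = if b then 1 else 0

count-cong : ∀ {k} {f g : Fin k → Bool} → (∀ i → f i ≡ g i) → count f ≡ count g
count-cong {zero}  _  = refl
count-cong {suc k} f≗g = cong₂ _+_ (cong bit (f≗g zero)) (count-cong (f≗g ∘ suc))

count-false : ∀ k → count {k} (λ _ → false) ≡ 0
count-false zero    = refl
count-false (suc k) = count-false k

headP-suc : ∀ {l} (P : OPath (suc l)) j → headP P (suc j) ≡ suc (headP (P ∘ suc) j)
headP-suc P j with P (suc j)
... | true  = refl
... | false = refl

indeg-suc-suc : ∀ {l} (P : OPath (suc (suc l))) i → indeg P (suc (suc i)) ≡ indeg (P ∘ suc) (suc i)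
indeg-suc-suc P i with P zero
... | true  = count-cong λ j → cong (λ v → does (v ≟ suc (suc i))) (headP-suc P j)
... | false = count-cong λ j → cong (λ v → does (v ≟ suc (suc i))) (headP-suc P j)

indeg-one : ∀ {l} (P : OPath (suc (suc l))) → indeg P (suc zero) ≡ bit (P zero) + bit (not (P (suc zero)))
indeg-one {l} P = cong₂ _+_ first-edge (trans (cong₂ _+_ second-edge later) (+-identityʳ _))
  where
  first-edge : bit (does (headP P zero ≟ suc zero)) ≡ bit (P zero)
  first-edge with P zero
  ... | true  = refl
  ... | false = refl
  second-edge : bit (does (headP P (suc zero) ≟ suc zero)) ≡ bit (not (P (suc zero)))
  second-edge with P (suc zero)
  ... | true  = refl
  ... | false = refl
  later : count (λ j → does (headP P (suc (suc j)) ≟ suc zero)) ≡ 0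
  later = trans (count-cong λ j → cong (λ v → does (v ≟ suc zero))
                                       (trans (headP-suc P (suc j)) (cong suc (headP-suc (P ∘ suc) j))))
                (count-false l)

isSwap-suc-suc : ∀ {l} (P : OPath (suc (suc l))) i → isSwap P (suc (suc i)) ≡ isSwap (P ∘ suc) (suc i)
isSwap-suc-suc P i rewrite indeg-suc-suc P i = refl

swaps-≤-changes : ∀ {l} (P : OPath (suc l)) → swaps P ≤ changes (tabulate P)
swaps-≤-changes {zero}  P = z≤n
swaps-≤-changes {suc l} P =
  +-mono-≤ first-swap (≤-trans (≤-reflexive (count-cong (isSwap-suc-suc P))) (swaps-≤-changes (P ∘ suc)))
  where
  first-swap : bit (isSwap P (suc zero)) ≤ bit (P zero xor P (suc zero))
  first-swap rewrite indeg-one P with P zero | P (suc zero)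
  ... | true  | true  = z≤n
  ... | true  | false = ≤-refl
  ... | false | true  = ≤-refl
  ... | false | false = z≤n

first-change : ∀ x xs → 1 ≤ changes (x ∷ xs) →
               ∃₂ λ pre rest → ∃₂ λ y (_ : x ≢ y) →
                 x ∷ xs ≡ pre ++ x ∷ y ∷ rest × changes (x ∷ xs) ≡ suc (changes (y ∷ rest))
first-change true  (false ∷ xs) _ = [] , xs , false , (λ ()) , refl , refl
first-change false (true  ∷ xs) _ = [] , xs , true  , (λ ()) , refl , refl
first-change true  (true  ∷ xs) h with first-change true xs h
... | pre , rest , y , x≢y , eq , c = true ∷ pre , rest , y , x≢y , cong (true ∷_) eq , c
first-change false (false ∷ xs) h with first-change false xs h
... | pre , rest , y , x≢y , eq , c = false ∷ pre , rest , y , x≢y , cong (false ∷_) eq , c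

private
  third-sign : ∀ {x y z : Bool} → x ≢ y → x ≢ z → y ≡ z
  third-sign x≢y x≢z = not-injective (trans (sym (¬-not x≢y)) (¬-not x≢z))

skip-two-changes : ∀ ps k → 2 + k ≤ changes ps →
                   ∃₂ λ pre rest → ∃₂ λ z (_ : ps ≡ pre ++ z ∷ rest) → 2 ≤ length pre × k ≤ changes (z ∷ rest)
skip-two-changes (x ∷ xs) k h with first-change x xs (≤-trans (s≤s z≤n) h)
... | pre₁ , rest₁ , y , _ , eq₁ , c₁ with subst (2 + k ≤_) c₁ h
... | s≤s h₁ with first-change y rest₁ (≤-trans (s≤s z≤n) h₁)
... | pre₂ , rest₂ , z , _ , eq₂ , c₂ with subst (1 + k ≤_) c₂ h₁
... | s≤s h₂ =
  pre₁ ++ x ∷ pre₂ ++ y ∷ [] , rest₂ , z , eq ,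
  ≤-trans (s≤s (length-++-≤ʳ (y ∷ []) {pre₂})) (length-++-≤ʳ (x ∷ pre₂ ++ y ∷ []) {pre₁}) , h₂
  where
  open ≡-Reasoning
  eq : x ∷ xs ≡ (pre₁ ++ x ∷ pre₂ ++ y ∷ []) ++ z ∷ rest₂
  eq = begin
    x ∷ xs                                    ≡⟨ eq₁ ⟩
    pre₁ ++ x ∷ y ∷ rest₁                     ≡⟨ cong (λ ys → pre₁ ++ x ∷ ys) eq₂ ⟩
    pre₁ ++ x ∷ pre₂ ++ y ∷ z ∷ rest₂         ≡⟨ cong (λ ys → pre₁ ++ x ∷ ys) (++-assoc pre₂ (y ∷ []) (z ∷ rest₂)) ⟨
    pre₁ ++ x ∷ (pre₂ ++ y ∷ []) ++ z ∷ rest₂ ≡⟨ ++-assoc pre₁ (x ∷ pre₂ ++ y ∷ []) (z ∷ rest₂) ⟨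
    (pre₁ ++ x ∷ pre₂ ++ y ∷ []) ++ z ∷ rest₂ ∎

flip-to : ∀ s ps k → 2 + k ≤ changes ps → ∃₂ λ pre rest → ps ≡ pre ++ not s ∷ s ∷ rest × k ≤ changes (s ∷ rest)
flip-to s (z ∷ zs) k h with first-change z zs (≤-trans (s≤s z≤n) h)
... | pre₁ , rest₁ , w , z≢w , eq₁ , c₁ with subst (2 + k ≤_) c₁ h
... | s≤s h₁ with w ≟ᵇ s
... | yes refl = pre₁ , rest₁ , subst (λ z′ → z ∷ zs ≡ pre₁ ++ z′ ∷ w ∷ rest₁) (¬-not z≢w) eq₁ , ≤-trans (n≤1+n k) h₁
... | no w≢s with first-change w rest₁ (≤-trans (s≤s z≤n) h₁)
...   | pre₂ , rest₂ , u , w≢u , eq₂ , c₂ with subst (1 + k ≤_) c₂ h₁ | third-sign w≢u w≢s | ¬-not w≢s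
...   | s≤s h₂ | refl | refl = pre₁ ++ z ∷ pre₂ , rest₂ , eq , h₂
  where
  open ≡-Reasoning
  eq : z ∷ zs ≡ (pre₁ ++ z ∷ pre₂) ++ not s ∷ s ∷ rest₂
  eq = begin
    z ∷ zs                                   ≡⟨ eq₁ ⟩
    pre₁ ++ z ∷ not s ∷ rest₁                ≡⟨ cong (λ ys → pre₁ ++ z ∷ ys) eq₂ ⟩
    pre₁ ++ z ∷ pre₂ ++ not s ∷ s ∷ rest₂    ≡⟨ ++-assoc pre₁ (z ∷ pre₂) _ ⟨
    (pre₁ ++ z ∷ pre₂) ++ not s ∷ s ∷ rest₂  ∎

block : ∀ s ps k → 4 + k ≤ changes ps →
        ∃₂ λ pre rest → ps ≡ pre ++ not s ∷ s ∷ rest × 2 ≤ length pre × k ≤ changes (s ∷ rest)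
block s ps k h with skip-two-changes ps (2 + k) h
... | pre₁ , rest₁ , z , eq₁ , len , h₁ with flip-to s (z ∷ rest₁) k h₁
... | pre₂ , rest₂ , eq₂ , h₂ =
  pre₁ ++ pre₂ , rest₂ , trans eq₁ (trans (cong (pre₁ ++_) eq₂) (sym (++-assoc pre₁ pre₂ _))) ,
  ≤-trans len (length-++-≤ˡ pre₁) , h₂

private
  four-more : ∀ k → 4 * suc k + 2 ≡ 4 + (4 * k + 2)
  four-more k = trans (cong (_+ 2) (*-suc 4 k)) (+-assoc 4 (4 * k) 2)

Blocks : List Sign → List Sign → Set
Blocks ps []       = 3 ≤ length ps
Blocks ps (s ∷ ss) = ∃₂ λ pre rest → ps ≡ pre ++ not s ∷ s ∷ rest × 2 ≤ length pre × Blocks (s ∷ rest) ss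

blocks : ∀ ss ps → 4 * length ss + 2 ≤ changes ps → Blocks ps ss
blocks [] ps h with skip-two-changes ps 0 h
... | pre , rest , z , refl , len , _ =
  ≤-trans (+-monoˡ-≤ 1 len) (≤-trans (+-monoʳ-≤ (length pre) (s≤s z≤n)) (≤-reflexive (sym (length-++ pre))))
blocks (s ∷ ss) ps h =
  let pre , rest , eq , len , h′ = block s ps (4 * length ss + 2) (subst (_≤ changes ps) (four-more (length ss)) h)
  in  pre , rest , eq , len , blocks ss (s ∷ rest) h′

blocks-length : ∀ ss ps → Blocks ps ss → suc (length ss) ≤ length ps
blocks-length []       ps       3≤ps = ≤-trans (s≤s z≤n) 3≤ps
blocks-length (s ∷ ss) ps (pre , rest , refl , _ , bl) =
  ≤-trans (s≤s (blocks-length ss (s ∷ rest) bl)) (length-++-≤ʳ (not s ∷ s ∷ rest) {pre})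

-- Threading the path through R and the reservoir

private
  step-room : ∀ f m k r b → f + suc (m + suc (suc k)) ≤ b + suc (suc r) → r ≤ k →
              f + suc m ≤ b × f + suc m + suc k ≤ b + suc r
  step-room f m k r b room r≤k =
    +-cancelʳ-≤ (suc (suc r)) (f + suc m) b
      (≤-trans (+-monoʳ-≤ (f + suc m) (s≤s (s≤s r≤k))) (≤-trans (≤-reflexive (e₁ f m k)) room)) ,
    +-cancelʳ-≤ 1 (f + suc m + suc k) (b + suc r)
      (≤-trans (≤-reflexive (e₂ f m k)) (≤-trans room (≤-reflexive (e₃ b r))))
    where
    e₁ : ∀ f m k → f + suc m + suc (suc k) ≡ f + suc (m + suc (suc k))
    e₁ = solve-∀
    e₂ : ∀ f m k → f + suc m + suc k + 1 ≡ f + suc (m + suc (suc k))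
    e₂ = solve-∀
    e₃ : ∀ b r → b + suc (suc r) ≡ b + suc r + 1
    e₃ = solve-∀

  last-room : ∀ f m b → f + suc (suc m) ≤ b + 1 → f + suc m ≤ b
  last-room f m b room = +-cancelʳ-≤ 1 (f + suc m) b (≤-trans (≤-reflexive (e f m)) room)
    where
    e : ∀ f m → f + suc m + 1 ≡ f + suc (suc m)
    e = solve-∀

module Embedding {n : ℕ} (D : Digraph n) (t : ℕ) (bip : Bipseudorandom t D) (X : Subset n) (b : ℕ)
                (6t≤b : 6 * t ≤ b) (sign : Fin n → Sign) (good : ∀ r → 2 * b ≤ ∣ N D (sign r) r ∩ X ∣) where

  open DigonPaths D t bip

  Good : V → Sign → Set
  Good r s = 2 * b ≤ ∣ N D s r ∩ X ∣

  Xs : List V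
  Xs = toList X

  nbrs : Sign → V → List V
  nbrs s r = toList (N D s r ∩ X)

  nbrs⊆X : ∀ s r → nbrs s r ⊆ Xs
  nbrs⊆X s r x∈ = ∈-toList⁺ X (proj₂ (x∈p∩q⁻ (N D s r) X (∈-toList⁻ _ x∈)))

  nbr-arc : ∀ s r {x} → x ∈ₗ nbrs s r → Arc D s r x
  nbr-arc s r {x} x∈ with x∈p∩q⁻ (N D s r) X (∈-toList⁻ (N D s r ∩ X) x∈)
  nbr-arc true  r {x} x∈ | x∈N , _ = trans (sym (lookup∘tabulate (adj D r) x)) ([]=⇒lookup x∈N)
  nbr-arc false r {x} x∈ | x∈N , _ = trans (sym (lookup∘tabulate (λ w → adj D w r) x)) ([]=⇒lookup x∈N)

  nbr-arc-in : ∀ s r {x} → x ∈ₗ nbrs s r → Arc D (not s) x r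
  nbr-arc-in true  = nbr-arc true
  nbr-arc-in false = nbr-arc false

  segment : ∀ F s s′ r₀ r L → 2 ≤ L → length F + L ≤ b → Good r₀ s → Good r s′ →
            Segment Xs F (nbrs s r₀) (nbrs s′ r) L
  segment F s s′ r₀ r L 2≤L room g₀ g =
    digon-segment {Xs} {F} (toList-unique X) (toList-unique (N D s r₀ ∩ X)) (toList-unique (N D s′ r ∩ X))
      (nbrs⊆X s r₀) (nbrs⊆X s′ r) (enough s r₀ g₀) (enough s′ r g) L 2≤L
      (≤-trans (≤-trans (≤-reflexive (cong (_+ 6 * t) (+-comm L (length F)))) (+-mono-≤ room 6t≤b))
        (≤-trans (large s r₀ g₀) (unique⇒length-≤ (toList-unique (N D s r₀ ∩ X)) (nbrs⊆X s r₀))))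
    where
    large : ∀ s r → Good r s → b + b ≤ length (nbrs s r)
    large s r g = ≤-trans (≤-reflexive (cong (λ k → b + k) (sym (+-identityʳ b))))
                          (≤-trans g (≤-reflexive (sym (length-toList (N D s r ∩ X)))))
    enough : ∀ s r → Good r s → length F + (t + t) ≤ length (nbrs s r)
    enough s r g =
      ≤-trans (+-mono-≤ (≤-trans (m≤m+n _ L) room) (≤-trans (m≤m+n (t + t) _) (≤-trans (≤-reflexive (six t)) 6t≤b)))
              (large s r g)
      where
      six : ∀ t → t + t + (t + t + t + t) ≡ 6 * t
      six = solve-∀

  record Route (F : List V) (r₀ : V) (ps : List Sign) (Rs : List V) (rL : V) : Set where
    field
      vertices : List V
      follows  : Follows D ps (r₀ ∷ vertices)
      unique   : Unique vertices
      within   : ∀ {x} → x ∈ₗ vertices → (x ∈ₗ Xs × x ∉ₗ F) ⊎ x ∈ₗ rL ∷ Rs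
      covers   : rL ∷ Rs ⊆ vertices
      ends     : lastOf r₀ vertices ≡ rL

  finish : ∀ {F r₀ rL s₀ mid q} → Segment Xs F (nbrs s₀ r₀) (nbrs (not q) rL) (suc (length mid)) → rL ∉ₗ Xs →
           Route F r₀ (s₀ ∷ mid ∷ʳ q) [] rL
  finish {F} {r₀} {rL} {s₀} {mid} {q} (a , M , linked , u , seg⊆X , seg#F , a∈ , z∈ , len) rL∉X = record
    { vertices = a ∷ M ++ rL ∷ []
    ; follows  = follows-++ D (nbr-arc s₀ r₀ a∈ ∷ follows-digons D linked (suc-injective (sym len)))
                            (subst (λ s → Arc D s _ rL) (not-involutive q) (nbr-arc-in (not q) rL z∈)) [ rL ]
    ; unique   = Unique.++⁺ u (unique-∷ (λ ()) []) λ { (x∈ , here refl) → rL∉X (seg⊆X x∈) }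
    ; within   = λ x∈ → case ∈-++⁻ (a ∷ M) x∈ of λ
                   { (inj₁ x∈seg)       → inj₁ (seg⊆X x∈seg , λ x∈F → seg#F (x∈seg , x∈F))
                   ; (inj₂ (here refl)) → inj₂ (here refl) }
    ; covers   = λ { (here refl) → ∈-++⁺ʳ (a ∷ M) (here refl) }
    ; ends     = lastOf-++ a M rL []
    }

  segment-vertices : ∀ {F A B L} → Segment Xs F A B L → List V
  segment-vertices (a , M , _) = a ∷ M

  segment-length : ∀ {F A B L} (seg : Segment Xs F A B L) → length (segment-vertices seg) ≡ L
  segment-length (_ , _ , _ , _ , _ , _ , _ , _ , len) = len

  private
    widen : ∀ {x rL r} {Rs : List V} → x ∈ₗ rL ∷ Rs → x ∈ₗ rL ∷ r ∷ Rs
    widen (here eq) = here eq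
    widen (there x∈) = there (there x∈)

  prepend : ∀ {F r₀ s₀ mid s r Rs rL rest} (seg : Segment Xs F (nbrs s₀ r₀) (nbrs s r) (suc (length mid))) →
            Unique (rL ∷ r ∷ Rs) → (∀ {x} → x ∈ₗ rL ∷ r ∷ Rs → x ∉ₗ Xs) →
            Route (F ++ segment-vertices seg) r (s ∷ rest) Rs rL → Route F r₀ (s₀ ∷ mid ++ not s ∷ s ∷ rest) (r ∷ Rs) rL
  prepend {F} {r₀} {s₀} {mid} {s} {r} {Rs} {rL} (a , M , linked , u , seg⊆X , seg#F , a∈ , z∈ , len) uR R∉X route = record
    { vertices = a ∷ M ++ r ∷ C
    ; follows  = follows-++ D (nbr-arc s₀ r₀ a∈ ∷ follows-digons D linked (suc-injective (sym len)))
                            (nbr-arc-in s r z∈) (Route.follows route)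
    ; unique   = Unique.++⁺ u (unique-∷ r∉C (Route.unique route)) seg#rC
    ; within   = within
    ; covers   = covers
    ; ends     = trans (lastOf-++ a M r C) (Route.ends route)
    }
    where
    C : List V
    C = Route.vertices route
    r∉C : r ∉ₗ C
    r∉C r∈ with Route.within route r∈
    ... | inj₁ (r∈X , _) = R∉X (there (here refl)) r∈X
    ... | inj₂ r∈        = proj₁ (unique-delete (rL ∷ []) uR) r∈
    seg#rC : Disjoint (a ∷ M) (r ∷ C)
    seg#rC (x∈seg , here refl) = R∉X (there (here refl)) (seg⊆X x∈seg)
    seg#rC (x∈seg , there x∈C) with Route.within route x∈C
    ... | inj₁ (_ , x∉) = x∉ (∈-++⁺ʳ F x∈seg)
    ... | inj₂ x∈       = R∉X (widen x∈) (seg⊆X x∈seg)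
    within : ∀ {x} → x ∈ₗ a ∷ M ++ r ∷ C → (x ∈ₗ Xs × x ∉ₗ F) ⊎ x ∈ₗ rL ∷ r ∷ Rs
    within x∈ with ∈-++⁻ (a ∷ M) x∈
    ... | inj₁ x∈seg         = inj₁ (seg⊆X x∈seg , λ x∈F → seg#F (x∈seg , x∈F))
    ... | inj₂ (here refl)   = inj₂ (there (here refl))
    ... | inj₂ (there x∈C) with Route.within route x∈C
    ...   | inj₁ (x∈X , x∉) = inj₁ (x∈X , x∉ ∘ ∈-++⁺ˡ)
    ...   | inj₂ x∈         = inj₂ (widen x∈)
    covers : rL ∷ r ∷ Rs ⊆ a ∷ M ++ r ∷ C
    covers (here refl)         = ∈-++⁺ʳ (a ∷ M) (there (Route.covers route (here refl)))
    covers (there (here refl)) = ∈-++⁺ʳ (a ∷ M) (here refl)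
    covers (there (there x∈))  = ∈-++⁺ʳ (a ∷ M) (there (Route.covers route (there x∈)))

  build : ∀ Rs {r₀ rL s₀ ps} F → Blocks (s₀ ∷ ps) (map sign Rs) → Good r₀ s₀ → Good rL (not (lastOf s₀ ps)) →
          length F + suc (length ps) ≤ b + suc (length Rs) → Unique (rL ∷ Rs) → (∀ {x} → x ∈ₗ rL ∷ Rs → x ∉ₗ Xs) →
          Route F r₀ (s₀ ∷ ps) Rs rL
  build [] {ps = ps} F 3≤ g₀ gL room uR R∉X with initLast ps
  build [] F (s≤s ()) g₀ gL room uR R∉X | []
  build [] {r₀} {rL} {s₀} F 3≤ g₀ gL room uR R∉X | mid ∷ʳ′ q =
    finish (segment F s₀ (not q) r₀ rL (suc (length mid)) (≤-pred (subst (3 ≤_) (cong suc (length-∷ʳ mid q)) 3≤))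
                    (last-room (length F) (length mid) b (subst (λ k → length F + suc k ≤ b + 1) (length-∷ʳ mid q) room))
                    g₀ (subst (λ z → Good rL (not z)) (lastOf-++ s₀ mid q []) gL))
           (R∉X (here refl))
  build (r ∷ Rs) F ([] , _ , _ , () , _) g₀ gL room uR R∉X
  build (r ∷ Rs) F (_ ∷ [] , _ , _ , s≤s () , _) g₀ gL room uR R∉X
  build (r ∷ Rs) {r₀} {rL} {s₀} F (.s₀ ∷ mid , rest , refl , 2≤L , bl) g₀ gL room uR R∉X =
    prepend seg uR R∉X
      (build Rs (F ++ segment-vertices seg) bl (good r)
        (subst (λ z → Good rL (not z)) (lastOf-++ s₀ mid (not (sign r)) (sign r ∷ rest)) gL)
        (subst (λ k → k + suc (length rest) ≤ b + suc (length Rs))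
               (sym (trans (length-++ F) (cong (λ k → length F + k) (segment-length seg)))) (proj₂ rooms))
        (proj₂ (unique-delete (rL ∷ []) uR)) (R∉X ∘ widen))
    where
    rooms : length F + suc (length mid) ≤ b × length F + suc (length mid) + suc (length rest) ≤ b + suc (length Rs)
    rooms = step-room (length F) (length mid) (length rest) (length Rs) b
              (subst (λ k → length F + suc k ≤ b + suc (suc (length Rs))) (length-++ mid) room)
              (≤-pred (subst (λ k → suc k ≤ suc (length rest)) (length-map sign Rs) (blocks-length _ _ bl)))
    seg : Segment Xs F (nbrs s₀ r₀) (nbrs (sign r) r) (suc (length mid))
    seg = segment F s₀ (sign r) r₀ r (suc (length mid)) 2≤L (proj₁ rooms) g₀ (good r)

  open Removal (Data.Fin._≟_ {n})

  module _ (R : Subset n) (R∩X≡∅ : ∀ x → x ∈ R → x ∉ X) {v v′ : V} (v∈R : v ∈ R) (v′∈R : v′ ∈ R) (v≢v′ : v ≢ v′) where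

    Rs : List V
    Rs = toList R ∖ (v ∷ v′ ∷ [])

    private
      Rs-inv : ∀ {x} → x ∈ₗ Rs → x ∈ R × x ∉ₗ v ∷ v′ ∷ []
      Rs-inv x∈ with ∈-∖⁻ (toList R) (v ∷ v′ ∷ []) x∈
      ... | x∈R , x∉ = ∈-toList⁻ R x∈R , x∉

      v′∉Rs : v′ ∉ₗ Rs
      v′∉Rs x∈ = proj₂ (Rs-inv x∈) (there (here refl))

      v∉v′Rs : v ∉ₗ v′ ∷ Rs
      v∉v′Rs (here v≡v′) = v≢v′ v≡v′
      v∉v′Rs (there v∈)  = proj₂ (Rs-inv v∈) (here refl)

    unique-v′Rs : Unique (v′ ∷ Rs)
    unique-v′Rs = unique-∷ v′∉Rs (∖-unique (v ∷ v′ ∷ []) (toList-unique R))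

    v′Rs∉X : ∀ {x} → x ∈ₗ v′ ∷ Rs → x ∉ₗ Xs
    v′Rs∉X (here refl) x∈X = R∩X≡∅ v′ v′∈R (∈-toList⁻ X x∈X)
    v′Rs∉X (there x∈)  x∈X = R∩X≡∅ _ (proj₁ (Rs-inv x∈)) (∈-toList⁻ X x∈X)

    |Rs| : length Rs + 2 ≡ ∣ R ∣
    |Rs| = ≤-antisym
      (≤-trans (≤-reflexive (+-comm (length Rs) 2))
        (≤-trans (unique⇒length-≤ (unique-∷ v∉v′Rs unique-v′Rs) v-v′-Rs⊆R) (≤-reflexive (length-toList R))))
      (≤-trans (≤-reflexive (sym (length-toList R))) (length-≤-∖ (v ∷ v′ ∷ []) (toList-unique R)))
      where
      v-v′-Rs⊆R : v ∷ v′ ∷ Rs ⊆ toList R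
      v-v′-Rs⊆R (here refl)         = ∈-toList⁺ R v∈R
      v-v′-Rs⊆R (there (here refl)) = ∈-toList⁺ R v′∈R
      v-v′-Rs⊆R (there (there x∈))  = ∈-toList⁺ R (proj₁ (Rs-inv x∈))

    R⊆ : ∀ {r} → r ∈ R → r ∈ₗ v ∷ v′ ∷ Rs
    R⊆ {r} r∈R with r Data.Fin.≟ v | r Data.Fin.≟ v′
    ... | yes r≡v | _        = here r≡v
    ... | no _    | yes r≡v′ = there (here r≡v′)
    ... | no r≢v  | no r≢v′  = there (there (∈-∖⁺ (v ∷ v′ ∷ []) (∈-toList⁺ R r∈R)
                                 λ { (here r≡v) → r≢v r≡v ; (there (here r≡v′)) → r≢v′ r≡v′ }))

    CoveringCopy : ∀ l → OPath (suc l) → Set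
    CoveringCopy l P = Σ (Fin (suc (suc l)) → Fin n) λ f → IsCopy D P f ×
      (f zero ≡ v) × (f (fromℕ (suc l)) ≡ v′) × (∀ i → f i ∈ (R ∪ X)) × (∀ r → r ∈ R → ∃[ i ] f i ≡ r)

    start∉route : ∀ {ps} (route : Route [] v ps Rs v′) → v ∉ₗ Route.vertices route
    start∉route route v∈ with Route.within route v∈
    ... | inj₁ (v∈X , _) = R∩X≡∅ v v∈R (∈-toList⁻ X v∈X)
    ... | inj₂ v∈        = v∉v′Rs v∈

    route⇒copy : ∀ {l} (P : OPath (suc l)) → Route [] v (tabulate P) Rs v′ → CoveringCopy l P
    route⇒copy P route with walk⇒copy D P (unique-∷ (start∉route route) (Route.unique route)) (Route.follows route)
    ... | f , copy , f0 , f-last , f∈ , onto =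
      f , copy , f0 , trans f-last (Route.ends route) , in-R∪X ∘ f∈ , λ r r∈R → onto (covered (R⊆ r∈R))
      where
      in-R∪X : ∀ {x} → x ∈ₗ v ∷ Route.vertices route → x ∈ R ∪ X
      in-R∪X (here refl) = x∈p∪q⁺ (inj₁ v∈R)
      in-R∪X (there x∈) with Route.within route x∈
      ... | inj₁ (x∈X , _)    = x∈p∪q⁺ (inj₂ (∈-toList⁻ X x∈X))
      ... | inj₂ (here refl)  = x∈p∪q⁺ (inj₁ v′∈R)
      ... | inj₂ (there x∈Rs) = x∈p∪q⁺ (inj₁ (proj₁ (Rs-inv x∈Rs)))
      covered : ∀ {r} → r ∈ₗ v ∷ v′ ∷ Rs → r ∈ₗ v ∷ Route.vertices route
      covered (here r≡v) = here r≡v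
      covered (there r∈) = there (Route.covers route r∈)

    covering-copy : ∀ l (P : OPath (suc l)) → suc (suc l) ≡ ∣ R ∣ + b → 4 * ∣ R ∣ ∸ 6 ≤ swaps P →
                    Good v (P zero) → Good v′ (not (P (fromℕ l))) → CoveringCopy l P
    covering-copy l P |P| many-swaps g g′ =
      route⇒copy P (build Rs [] (blocks (map sign Rs) (tabulate P) enough-changes) g
                      (subst (λ z → Good v′ (not z)) (sym (lastOf-tabulate P)) g′) room unique-v′Rs v′Rs∉X)
      where
      enough-changes : 4 * length (map sign Rs) + 2 ≤ changes (tabulate P)
      enough-changes = ≤-trans (≤-reflexive changes-needed) (≤-trans many-swaps (swaps-≤-changes P))
        where
        open ≡-Reasoning
        e : ∀ k → 4 * (k + 2) ≡ 4 * k + 2 + 6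
        e = solve-∀
        changes-needed : 4 * length (map sign Rs) + 2 ≡ 4 * ∣ R ∣ ∸ 6
        changes-needed = begin
          4 * length (map sign Rs) + 2       ≡⟨ cong (λ k → 4 * k + 2) (length-map sign Rs) ⟩
          4 * length Rs + 2                  ≡⟨ m+n∸n≡m _ 6 ⟨
          4 * length Rs + 2 + 6 ∸ 6          ≡⟨ cong (_∸ 6) (e (length Rs)) ⟨
          4 * (length Rs + 2) ∸ 6            ≡⟨ cong (λ k → 4 * k ∸ 6) |Rs| ⟩
          4 * ∣ R ∣ ∸ 6                      ∎
      room : 0 + suc (length (tabulate (P ∘ suc))) ≤ b + suc (length Rs)
      room = ≤-reflexive (suc-injective (begin
        suc (suc (length (tabulate (P ∘ suc)))) ≡⟨ cong (λ k → 2 + k) (length-tabulate (P ∘ suc)) ⟩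
        suc (suc l)                             ≡⟨ |P| ⟩
        ∣ R ∣ + b                               ≡⟨ cong (_+ b) |Rs| ⟨
        length Rs + 2 + b                       ≡⟨ e (length Rs) b ⟩
        suc (b + suc (length Rs))               ∎))
        where
        open ≡-Reasoning
        e : ∀ k b → k + 2 + b ≡ suc (b + suc k)
        e = solve-∀

⟦⟧≡mkℚ : ∀ k → ⟦ k ⟧ ≡ mkℚ (+ k) 0 (Coprimality.sym (1-coprimeTo k))
⟦⟧≡mkℚ k = Q.↥p/↧p≡p (mkℚ (+ k) 0 (Coprimality.sym (1-coprimeTo k)))

⟦⟧-cancel-≤ : ∀ {a b} → ⟦ a ⟧ Q.≤ ⟦ b ⟧ → a ≤ b
⟦⟧-cancel-≤ {a} {b} a≤b with subst₂ Q._≤_ (⟦⟧≡mkℚ a) (⟦⟧≡mkℚ b) a≤b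
... | *≤* a≤b′ with subst₂ ℤ._≤_ (ℤ.*-identityʳ (+ a)) (ℤ.*-identityʳ (+ b)) a≤b′
... | +≤+ a≤b″ = a≤b″

⟦⟧-mono-≤ : ∀ {a b} → a ≤ b → ⟦ a ⟧ Q.≤ ⟦ b ⟧
⟦⟧-mono-≤ {a} {b} a≤b = subst₂ Q._≤_ (sym (⟦⟧≡mkℚ a)) (sym (⟦⟧≡mkℚ b))
  (*≤* (subst₂ ℤ._≤_ (sym (ℤ.*-identityʳ (+ a))) (sym (ℤ.*-identityʳ (+ b))) (+≤+ a≤b)))

⟦⟧-injective : ∀ {a b} → ⟦ a ⟧ ≡ ⟦ b ⟧ → a ≡ b
⟦⟧-injective a≡b = ≤-antisym (⟦⟧-cancel-≤ (Q.≤-reflexive a≡b)) (⟦⟧-cancel-≤ (Q.≤-reflexive (sym a≡b)))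

⟦⟧-homo-* : ∀ a b → ⟦ a ⟧ Q.* ⟦ b ⟧ ≡ ⟦ a * b ⟧
⟦⟧-homo-* a b rewrite ⟦⟧≡mkℚ a | ⟦⟧≡mkℚ b = cong (_/ 1) (sym (ℤ.pos-* a b))

⟦⟧-homo-+ : ∀ a b → ⟦ a ⟧ Q.+ ⟦ b ⟧ ≡ ⟦ a + b ⟧
⟦⟧-homo-+ a b rewrite ⟦⟧≡mkℚ a | ⟦⟧≡mkℚ b =
  cong (_/ 1) (trans (cong₂ ℤ._+_ (ℤ.*-identityʳ (+ a)) (ℤ.*-identityʳ (+ b))) (sym (ℤ.pos-+ a b)))

sixfold-≤ : ∀ (q : ℚ) b t → ⟦ b ⟧ ≡ q → q Q.* (+ 1 / 6) Q.≥ ⟦ 2 * t ⟧ → 6 * t ≤ b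
sixfold-≤ q b t b≡q q/6≥2t = ≤-trans (≤-trans (m≤m+n (6 * t) (6 * t)) (≤-reflexive (twelve t))) (⟦⟧-cancel-≤ 12t≤b)
  where
  twelve : ∀ t → 6 * t + 6 * t ≡ 2 * t * 6
  twelve = solve-∀
  12t≤b : ⟦ 2 * t * 6 ⟧ Q.≤ ⟦ b ⟧
  12t≤b = subst₂ Q._≤_ (⟦⟧-homo-* (2 * t) 6) (trans (Q.*-assoc ⟦ b ⟧ (+ 1 / 6) ⟦ 6 ⟧) (Q.*-identityʳ ⟦ b ⟧))
            (Q.*-monoʳ-≤-nonNeg ⟦ 6 ⟧ (subst (λ z → ⟦ 2 * t ⟧ Q.≤ z Q.* (+ 1 / 6)) (sym b≡q) q/6≥2t))

larger-half : ∀ (w : ℚ) x y → 0ℚ Q.≤ w → w Q.+ w Q.≤ ⟦ x + y ⟧ → w Q.* (+ 1 / 2) Q.≤ ⟦ x ⟧ ⊎ w Q.* (+ 1 / 2) Q.≤ ⟦ y ⟧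
larger-half w x y 0≤w 2w≤x+y with w Q.* (+ 1 / 2) Q.≤? ⟦ x ⟧ | w Q.* (+ 1 / 2) Q.≤? ⟦ y ⟧
... | yes h≤x | _       = inj₁ h≤x
... | no _    | yes h≤y = inj₂ h≤y
... | no h≰x  | no h≰y  = ⊥-elim (Q.<-irrefl refl (Q.<-≤-trans x+y<w (Q.≤-trans w≤2w 2w≤x+y)))
  where
  x+y<w : ⟦ x + y ⟧ < w
  x+y<w = subst₂ _<_ (⟦⟧-homo-+ x y) (trans (sym (Q.*-distribˡ-+ w (+ 1 / 2) (+ 1 / 2))) (Q.*-identityʳ w))
            (Q.+-mono-< (Q.≰⇒> h≰x) (Q.≰⇒> h≰y))
  w≤2w : w Q.≤ w Q.+ w
  w≤2w = subst (Q._≤ w Q.+ w) (Q.+-identityˡ w) (Q.+-monoˡ-≤ w 0≤w)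

half-degree : ∀ α n x y → 0ℚ < α → ⟦ 2 ⟧ Q.* α Q.* ⟦ n ⟧ Q.≤ ⟦ x + y ⟧ →
              α Q.* ⟦ n ⟧ Q.* (+ 1 / 2) Q.≤ ⟦ x ⟧ ⊎ α Q.* ⟦ n ⟧ Q.* (+ 1 / 2) Q.≤ ⟦ y ⟧
half-degree α n x y 0<α = larger-half w x y 0≤w ∘ subst (Q._≤ ⟦ x + y ⟧) doubled
  where
  w : ℚ
  w = α Q.* ⟦ n ⟧
  0≤w : 0ℚ Q.≤ w
  0≤w = subst (Q._≤ w) (Q.*-zeroˡ ⟦ n ⟧) (Q.*-monoʳ-≤-nonNeg ⟦ n ⟧ {{nonNegative (⟦⟧-mono-≤ {0} {n} z≤n)}} (Q.<⇒≤ 0<α))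
  doubled : ⟦ 2 ⟧ Q.* α Q.* ⟦ n ⟧ ≡ w Q.+ w
  doubled = trans (Q.*-assoc ⟦ 2 ⟧ α ⟦ n ⟧)
                  (trans (Q.*-distribʳ-+ w 1ℚ 1ℚ) (cong₂ Q._+_ (Q.*-identityˡ w) (Q.*-identityˡ w)))

half-comm : ∀ α n → α Q.* (+ 1 / 2) Q.* ⟦ n ⟧ ≡ α Q.* ⟦ n ⟧ Q.* (+ 1 / 2)
half-comm α n = trans (Q.*-assoc α (+ 1 / 2) ⟦ n ⟧)
                      (trans (cong (α Q.*_) (Q.*-comm (+ 1 / 2) ⟦ n ⟧)) (sym (Q.*-assoc α ⟦ n ⟧ (+ 1 / 2))))

lemma6p9 : (α β ε : ℚ) → 0ℚ < α → 0ℚ < β → 0ℚ < ε →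
    (m n : ℕ) (D : Digraph n) (t : ℕ) → ⟦ t ⟧ ≡ ε Q.* ⟦ n ⟧ →
    β Q.* ⟦ m ⟧ Q.* (+ 1 / 6) Q.≥ ⟦ 2 * t ⟧ →
    Bipseudorandom t D →
    MinTotDegAtLeast D (⟦ 2 ⟧ Q.* α Q.* ⟦ n ⟧) →
    (X : Subset n) → Reservoir D α β m X →
    (R : Subset n) → (∀ x → x ∈ R → x ∉ X) → 2 ≤ ∣ R ∣ →
    (v v' : Fin n) → v ∈ R → v' ∈ R → v ≢ v' →
    (l : ℕ) (P : OPath (suc l)) →
    (b : ℕ) → ⟦ b ⟧ ≡ β Q.* ⟦ m ⟧ → suc (suc l) ≡ ∣ R ∣ + b →
    4 * ∣ R ∣ ∸ 6 ≤ swaps P →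
    Compatible D (α Q.* (+ 1 / 2)) P v v' →
    Σ (Fin (suc (suc l)) → Fin n) λ f → IsCopy D P f ×
      (f zero ≡ v) × (f (fromℕ (suc l)) ≡ v') ×
      (∀ i → f i ∈ (R ∪ X)) × (∀ r → r ∈ R → ∃[ i ] f i ≡ r)
lemma6p9 α β ε 0<α _ _ m n D t _ 2t≤βm/6 bip min-degree X (b′ , b′≡βm , _ , reservoir-nbrs , _)
         R R∩X≡∅ _ v v′ v∈R v′∈R v≢v′ l P b b≡βm |P| many-swaps (compatible₀ , compatible₁) =
  covering-copy R R∩X≡∅ v∈R v′∈R v≢v′ l P |P| many-swaps
    (good-at v (P zero) (half-compatible {deg D (P zero) v} compatible₀))
    (good-at v′ (not (P (fromℕ l))) (half-compatible {deg D (not (P (fromℕ l))) v′} compatible₁))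
  where
  half-compatible : ∀ {d} → α Q.* (+ 1 / 2) Q.* ⟦ n ⟧ Q.≤ ⟦ d ⟧ → α Q.* ⟦ n ⟧ Q.* (+ 1 / 2) Q.≤ ⟦ d ⟧
  half-compatible {d} = subst (Q._≤ ⟦ d ⟧) (half-comm α n)
  good-at : ∀ r s → α Q.* ⟦ n ⟧ Q.* (+ 1 / 2) Q.≤ ⟦ deg D s r ⟧ → 2 * b ≤ ∣ N D s r ∩ X ∣
  good-at r s large = subst (λ k → 2 * k ≤ ∣ N D s r ∩ X ∣) (⟦⟧-injective {b′} {b} (trans b′≡βm (sym b≡βm)))
                            (reservoir-nbrs r s large)
  signed : ∀ r → Σ Sign λ s → 2 * b ≤ ∣ N D s r ∩ X ∣
  signed r with half-degree α n (deg D true r) (deg D false r) 0<α (min-degree r)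
  ... | inj₁ large = true , good-at r true large
  ... | inj₂ large = false , good-at r false large
  open Embedding D t bip X b (sixfold-≤ (β Q.* ⟦ m ⟧) b t b≡βm 2t≤βm/6) (proj₁ ∘ signed) (proj₂ ∘ signed)
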